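{- $458 \leq R(4,4,4,4)$.
   Context: $R(4,4,4,4)$ is the four-color Ramsey number: the smallest integer $l$ such that every coloring of the edges of the complete graph $K_l$ with four colors contains a complete subgraph $K_4$ all of whose edges have the same color. -}

module Defs where

open import Data.Nat using (ℕ)
open import Data.Fin using (Fin)
open import Data.Product using (Σ; _×_)
open import Relation.Binary.PropositionalEquality using (_≡_; _≢_)

-- A 4-colouring of the edges of K_l: a colour for each ordered pair of
-- vertices, required to be symmetric (so it is a colouring of unordered
-- pairs); the value on the diagonal is irrelevant.
EdgeColouring : ℕ → Set
EdgeColouring l = Fin l → Fin l → Fin 4

Symmetric : ∀ {l} → EdgeColouring l → Set
Symmetric {l} χ = (i j : Fin l) → χ i j ≡ χ j i

HasMonoK4 : ∀ {l} → EdgeColouring l → Set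
HasMonoK4 {l} χ =
  Σ (Fin 4) λ k → Σ (Fin l) λ a → Σ (Fin l) λ b → Σ (Fin l) λ c → Σ (Fin l) λ d →
    (a ≢ b × a ≢ c × a ≢ d × b ≢ c × b ≢ d × c ≢ d) ×
    (χ a b ≡ k × χ a c ≡ k × χ a d ≡ k × χ b c ≡ k × χ b d ≡ k × χ c d ≡ k)

-- Every 4-colouring of the edges of K_l contains a monochromatic K_4.
-- R(4,4,4,4) is the least l with this property.
RamseyProperty4444 : ℕ → Set
RamseyProperty4444 l = (χ : EdgeColouring l) → Symmetric χ → HasMonoK4 χ

module Submission where

-- The prime p = 457 satisfies p ≡ 1 (mod 8). Colour the edge {i, j} of K_p by
-- the class of i − j in ℤ/p* modulo fourth powers, read off from the fourth
-- root of unity (i − j)^114 mod p. Since −1 is a fourth power this colouring is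
-- symmetric, and it is K4-free, which gives the bound: a K4-free colouring of
-- K_457 restricts to every smaller complete graph.
--
-- Every affine map x ↦ s·x + c with s
-- invertible acts on the colouring by multiplying all edge colours (as roots of
-- unity) by a common factor; so any monochromatic K4 can be moved to one
-- containing the vertices 0 and 1, and a short finite check rules those out.

open import Defs
open import Data.Nat using (ℕ; zero; suc; _+_; _*_; _^_; _%_; _≤_; _<_; _≤?_; _≡ᵇ_)
open import Data.Bool using (if_then_else_)
open import Data.Nat.Properties using (≰⇒>; *-assoc; *-comm; *-zeroʳ; *-identityˡ; +-identityʳ; ^-*-assoc; [m*n]*[o*p]≡[m*o]*[n*p])
open import Data.Nat.Properties using () renaming (_≟_ to _≟ℕ_)
open import Data.Nat.DivMod using (_mod_; %-distribˡ-+; %-distribˡ-*; m%n%n≡m%n; [m+kn]%n≡m%n; m<n⇒m%n≡m)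
open import Data.Nat.Tactic.RingSolver using (solve-∀)
open import Data.Fin using (Fin; toℕ; inject≤; _≟_)
open import Data.Fin.Patterns using (0F; 1F; 2F; 3F)
open import Data.Fin.Properties using (toℕ-injective; toℕ<n; toℕ-fromℕ<; inject≤-injective; all?)
open import Data.List using (List; filter; allFin)
open import Data.List.Relation.Unary.All as All using (All)
open import Data.List.Membership.Propositional using (_∈_)
open import Data.List.Membership.Propositional.Properties using (∈-filter⁺; ∈-allFin)
open import Data.Product using (Σ-syntax; _×_; _,_; proj₁)
open import Data.Sum using (_⊎_; [_,_]′)
open import Data.Empty using (⊥-elim)
open import Function using (id; _∘_)
open import Relation.Nullary using (¬_; Dec; yes; no)
open import Relation.Nullary.Decidable using (toWitness; _×-dec_; _⊎-dec_; _→-dec_; ¬?)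
open import Relation.Binary.PropositionalEquality

IsMonoK4 : ∀ {l} → EdgeColouring l → Fin 4 → (a b c d : Fin l) → Set
IsMonoK4 χ k a b c d =
  (a ≢ b × a ≢ c × a ≢ d × b ≢ c × b ≢ d × c ≢ d) ×
  (χ a b ≡ k × χ a c ≡ k × χ a d ≡ k × χ b c ≡ k × χ b d ≡ k × χ c d ≡ k)

record ColourMap {l n} (χ : EdgeColouring l) (ψ : EdgeColouring n) : Set where
  field
    vertex    : Fin l → Fin n
    recolour  : Fin 4 → Fin 4
    injective : ∀ {i j} → vertex i ≡ vertex j → i ≡ j
    edge      : ∀ {i j} → i ≢ j → ψ (vertex i) (vertex j) ≡ recolour (χ i j)

  mapMonoK4 : ∀ {k a b c d} → IsMonoK4 χ k a b c d →
              IsMonoK4 ψ (recolour k) (vertex a) (vertex b) (vertex c) (vertex d)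
  mapMonoK4 {k} ((ab , ac , ad , bc , bd , cd) , (χab , χac , χad , χbc , χbd , χcd)) =
    (apart ab , apart ac , apart ad , apart bc , apart bd , apart cd) ,
    (image ab χab , image ac χac , image ad χad , image bc χbc , image bd χbd , image cd χcd)
    where
    apart : ∀ {i j} → i ≢ j → vertex i ≢ vertex j
    apart i≢j = i≢j ∘ injective

    image : ∀ {i j} → i ≢ j → χ i j ≡ k → ψ (vertex i) (vertex j) ≡ recolour k
    image i≢j χij = trans (edge i≢j) (cong recolour χij)

restrict : ∀ {l n} → l ≤ n → EdgeColouring n → EdgeColouring l
restrict l≤n χ i j = χ (inject≤ i l≤n) (inject≤ j l≤n)

inclusion : ∀ {l n} (l≤n : l ≤ n) (χ : EdgeColouring n) → ColourMap (restrict l≤n χ) χ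
inclusion l≤n χ = record
  { vertex    = λ i → inject≤ i l≤n
  ; recolour  = id
  ; injective = inject≤-injective l≤n l≤n _ _
  ; edge      = λ _ → refl
  }

ramseyLowerBound : ∀ {n l} (χ : EdgeColouring n) → Symmetric χ →
                   (∀ k a b c d → ¬ IsMonoK4 χ k a b c d) →
                   RamseyProperty4444 l → n < l
ramseyLowerBound {n} {l} χ χ-sym K4-free ramsey with l ≤? n
... | no l≰n = ≰⇒> l≰n
... | yes l≤n with ramsey (restrict l≤n χ) (λ i j → χ-sym _ _)
...   | k , a , b , c , d , mono =
  ⊥-elim (K4-free _ _ _ _ _ (ColourMap.mapMonoK4 (inclusion l≤n χ) mono))

-- Polynomial identities behind the representation x + m·y of x − y modulo
-- m + 1 (used in the module Modular below).
cancel-identity : ∀ m x y → x + y * suc m ≡ x + m * y + y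
cancel-identity = solve-∀

swap-identity : ∀ m x y → y + m * x + m * y * suc m ≡ m * (x + m * y) + y * suc m
swap-identity = solve-∀

affine-identity : ∀ m s c x y → s * x + c + m * (s * y + c) ≡ s * (x + m * y) + c * suc m
affine-identity = solve-∀

-- The difference x − y is represented by
-- x ⊖ y = x + m·y, which avoids truncated subtraction. As a ≋ b unfolds to an
-- equation between residues, a and b cannot be inferred from a proof of it and
-- are often passed explicitly.
module Modular (m : ℕ) where

  n : ℕ
  n = suc m

  infix 4 _≋_
  _≋_ : ℕ → ℕ → Set
  a ≋ b = a % n ≡ b % n

  %-≋ : ∀ a → a % n ≋ a
  %-≋ a = m%n%n≡m%n a n

  +-≋ : ∀ {a b c d} → a ≋ b → c ≋ d → a + c ≋ b + d
  +-≋ {a} {b} {c} {d} a≋b c≋d = begin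
    (a + c) % n             ≡⟨ %-distribˡ-+ a c n ⟩
    (a % n + c % n) % n     ≡⟨ cong₂ (λ x y → (x + y) % n) a≋b c≋d ⟩
    (b % n + d % n) % n     ≡⟨ %-distribˡ-+ b d n ⟨
    (b + d) % n             ∎
    where open ≡-Reasoning

  *-≋ : ∀ {a b c d} → a ≋ b → c ≋ d → a * c ≋ b * d
  *-≋ {a} {b} {c} {d} a≋b c≋d = begin
    (a * c) % n             ≡⟨ %-distribˡ-* a c n ⟩
    (a % n * (c % n)) % n   ≡⟨ cong₂ (λ x y → (x * y) % n) a≋b c≋d ⟩
    (b % n * (d % n)) % n   ≡⟨ %-distribˡ-* b d n ⟨
    (b * d) % n             ∎
    where open ≡-Reasoning

  ^-≋ : ∀ a b → a ≋ b → ∀ e → a ^ e ≋ b ^ e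
  ^-≋ a b a≋b zero    = refl
  ^-≋ a b a≋b (suc e) = *-≋ {a} {b} {a ^ e} {b ^ e} a≋b (^-≋ a b a≋b e)

  multiple-≋ : ∀ a k → a + k * n ≋ a
  multiple-≋ a k = [m+kn]%n≡m%n a k n

  <-≋⇒≡ : ∀ {a b} → a < n → b < n → a ≋ b → a ≡ b
  <-≋⇒≡ {a} {b} a<n b<n a≋b =
    trans (sym (m<n⇒m%n≡m a<n)) (trans a≋b (m<n⇒m%n≡m b<n))

  cancel-≋0 : ∀ {v s d} → v * s ≋ 1 → s * d ≋ 0 → d ≋ 0
  cancel-≋0 {v} {s} {d} vs≋1 sd≋0 = begin
    d % n                   ≡⟨ cong (_% n) (*-identityˡ d) ⟨
    (1 * d) % n             ≡⟨ *-≋ {1} {v * s} {d} {d} (sym vs≋1) refl ⟩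
    (v * s * d) % n         ≡⟨ cong (_% n) (*-assoc v s d) ⟩
    (v * (s * d)) % n       ≡⟨ *-≋ {v} {v} {s * d} {0} refl sd≋0 ⟩
    (v * 0) % n             ≡⟨ cong (_% n) (*-zeroʳ v) ⟩
    0                       ∎
    where open ≡-Reasoning

  infixl 6 _⊖_
  _⊖_ : ℕ → ℕ → ℕ
  x ⊖ y = x + m * y

  ⊖-≋ : ∀ {a b c d} → a ≋ b → c ≋ d → a ⊖ c ≋ b ⊖ d
  ⊖-≋ {a} {b} {c} {d} a≋b c≋d = +-≋ {a} {b} {m * c} {m * d} a≋b (*-≋ {m} {m} {c} {d} refl c≋d)

  ⊖≋0⇒≋ : ∀ {x y} → x ⊖ y ≋ 0 → x ≋ y
  ⊖≋0⇒≋ {x} {y} x⊖y≋0 = begin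
    x % n                   ≡⟨ multiple-≋ x y ⟨
    (x + y * n) % n         ≡⟨ cong (_% n) (cancel-identity m x y) ⟩
    (x ⊖ y + y) % n         ≡⟨ +-≋ {x ⊖ y} {0} {y} {y} x⊖y≋0 refl ⟩
    y % n                   ∎
    where open ≡-Reasoning

  ⊖-self : ∀ x → x ⊖ x ≋ 0
  ⊖-self x = trans (cong (_% n) (*-comm n x)) (multiple-≋ 0 x)

  ≋⇒⊖≋0 : ∀ {x y} → x ≋ y → x ⊖ y ≋ 0
  ≋⇒⊖≋0 {x} {y} x≋y = trans (⊖-≋ {x} {y} {y} {y} x≋y refl) (⊖-self y)

  -- y − x ≡ −1 · (x − y), with −1 represented by m.
  ⊖-swap : ∀ x y → y ⊖ x ≋ m * (x ⊖ y)
  ⊖-swap x y = begin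
    (y ⊖ x) % n                   ≡⟨ multiple-≋ (y ⊖ x) (m * y) ⟨
    (y ⊖ x + m * y * n) % n       ≡⟨ cong (_% n) (swap-identity m x y) ⟩
    (m * (x ⊖ y) + y * n) % n     ≡⟨ multiple-≋ (m * (x ⊖ y)) y ⟩
    (m * (x ⊖ y)) % n             ∎
    where open ≡-Reasoning

  ⊖-affine : ∀ s c x y → (s * x + c) ⊖ (s * y + c) ≋ s * (x ⊖ y)
  ⊖-affine s c x y = trans (cong (_% n) (affine-identity m s c x y)) (multiple-≋ (s * (x ⊖ y)) c)

^-distribʳ-* : ∀ a b e → (a * b) ^ e ≡ a ^ e * b ^ e
^-distribʳ-* a b zero    = refl
^-distribʳ-* a b (suc e) = begin
  a * b * (a * b) ^ e        ≡⟨ cong (a * b *_) (^-distribʳ-* a b e) ⟩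
  a * b * (a ^ e * b ^ e)    ≡⟨ [m*n]*[o*p]≡[m*o]*[n*p] a b (a ^ e) (b ^ e) ⟩
  a * a ^ e * (b * b ^ e)    ∎
  where open ≡-Reasoning

-- From now on we work modulo the prime p = 457.
open Modular 456 renaming (n to p)

-- The fourth power residue symbol d^((p−1)/4) mod p.
quartic : ℕ → ℕ
quartic d = d ^ 114 % p

quartic-≋ : ∀ a b → a ≋ b → quartic a ≡ quartic b
quartic-≋ a b a≋b = ^-≋ a b a≋b 114

quartic-* : ∀ a b → quartic (a * b) ≡ quartic a * quartic b % p
quartic-* a b = trans (cong (_% p) (^-distribʳ-* a b 114)) (%-distribˡ-* (a ^ 114) (b ^ 114) p)

-- The fourth roots of unity modulo p: the powers of 348 = 13^114 mod p,
-- where 13 generates ℤ/p*.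
root : Fin 4 → ℕ
root 0F = 1
root 1F = 348
root 2F = 456
root 3F = 109

-- The exponent k of a fourth root of unity root k (junk on other values).
exponent : ℕ → Fin 4
exponent r =
  if r ≡ᵇ 1 then 0F else if r ≡ᵇ 348 then 1F else if r ≡ᵇ 456 then 2F else 3F

root⁴≡1 : ∀ k → root k ^ 4 % p ≡ 1
root⁴≡1 0F = refl
root⁴≡1 1F = refl
root⁴≡1 2F = refl
root⁴≡1 3F = refl

quarticClass : ℕ → Fin 4
quarticClass d = exponent (quartic d)

quartic-root-table : ∀ (e : Fin p) → toℕ e ≢ 0 → quartic (toℕ e) ≡ root (quarticClass (toℕ e))
quartic-root-table = toWitness {a? = all? λ e →
  ¬? (toℕ e ≟ℕ 0) →-dec (quartic (toℕ e) ≟ℕ root (quarticClass (toℕ e)))} _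

quartic-root : ∀ d → ¬ (d ≋ 0) → quartic d ≡ root (quarticClass d)
quartic-root d d≢0 = begin
  quartic d                     ≡⟨ quartic-≋ d (d % p) (sym (%-≋ d)) ⟩
  quartic (d % p)               ≡⟨ table d≢0 ⟩
  root (quarticClass (d % p))   ≡⟨ cong (root ∘ exponent) (quartic-≋ (d % p) d (%-≋ d)) ⟩
  root (quarticClass d)         ∎
  where
  open ≡-Reasoning
  table : d % p ≢ 0 → quartic (d % p) ≡ root (quarticClass (d % p))
  table = subst (λ r → r ≢ 0 → quartic r ≡ root (quarticClass r))
                (toℕ-fromℕ< _) (quartic-root-table (d mod p))

fermat : ∀ d → ¬ (d ≋ 0) → d ^ 456 ≋ 1
fermat d d≢0 = begin
  d ^ 456 % p                       ≡⟨ cong (_% p) (^-*-assoc d 114 4) ⟨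
  (d ^ 114) ^ 4 % p                 ≡⟨ ^-≋ (d ^ 114) (quartic d) (sym (%-≋ (d ^ 114))) 4 ⟩
  quartic d ^ 4 % p                 ≡⟨ cong (λ r → r ^ 4 % p) (quartic-root d d≢0) ⟩
  root (quarticClass d) ^ 4 % p     ≡⟨ root⁴≡1 (quarticClass d) ⟩
  1                                 ∎
  where open ≡-Reasoning

colouring : EdgeColouring p
colouring i j = quarticClass (toℕ i ⊖ toℕ j)

-- −1 is a fourth power modulo p, so the colouring is symmetric.
colouring-symmetric : Symmetric colouring
colouring-symmetric i j = cong exponent (begin
  quartic (x ⊖ y)                   ≡⟨ m%n%n≡m%n ((x ⊖ y) ^ 114) p ⟨
  quartic (x ⊖ y) % p               ≡⟨ cong (_% p) (*-identityˡ (quartic (x ⊖ y))) ⟨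
  quartic 456 * quartic (x ⊖ y) % p ≡⟨ quartic-* 456 (x ⊖ y) ⟨
  quartic (456 * (x ⊖ y))           ≡⟨ quartic-≋ (y ⊖ x) (456 * (x ⊖ y)) (⊖-swap x y) ⟨
  quartic (y ⊖ x)                   ∎)
  where
  open ≡-Reasoning
  x = toℕ i
  y = toℕ j

distinct⇒nonzero : ∀ {i j : Fin p} → i ≢ j → ¬ (toℕ i ⊖ toℕ j ≋ 0)
distinct⇒nonzero {i} {j} i≢j i⊖j≋0 =
  i≢j (toℕ-injective (<-≋⇒≡ (toℕ<n i) (toℕ<n j) (⊖≋0⇒≋ {toℕ i} {toℕ j} i⊖j≋0)))

affine : ℕ → ℕ → Fin p → Fin p
affine s c x = (s * toℕ x + c) mod p

toℕ-affine : ∀ s c x → toℕ (affine s c x) ≡ (s * toℕ x + c) % p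
toℕ-affine s c x = toℕ-fromℕ< _

-- For invertible s the affine map x ↦ s·x + c is a symmetry of the colouring
-- up to recolouring: differences are multiplied by s, hence the root of unity
-- of every edge colour is multiplied by quartic s.
affineMap : ∀ s c v → v * s ≋ 1 → ColourMap colouring colouring
affineMap s c v vs≋1 = record
  { vertex    = affine s c
  ; recolour  = λ k → exponent (quartic s * root k % p)
  ; injective = injective
  ; edge      = edge
  }
  where
  open ≡-Reasoning

  image-⊖ : ∀ x y → toℕ (affine s c x) ⊖ toℕ (affine s c y) ≋ s * (toℕ x ⊖ toℕ y)
  image-⊖ x y = trans (⊖-≋ {toℕ (affine s c x)} {s * toℕ x + c}
                            {toℕ (affine s c y)} {s * toℕ y + c} (image x) (image y))
                       (⊖-affine s c (toℕ x) (toℕ y))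
    where
    image : ∀ x → toℕ (affine s c x) ≋ s * toℕ x + c
    image x = trans (cong (_% p) (toℕ-affine s c x)) (%-≋ (s * toℕ x + c))

  injective : ∀ {x y} → affine s c x ≡ affine s c y → x ≡ y
  injective {x} {y} eq =
    toℕ-injective (<-≋⇒≡ (toℕ<n x) (toℕ<n y)
      (⊖≋0⇒≋ {toℕ x} {toℕ y} (cancel-≋0 {v} {s} {toℕ x ⊖ toℕ y} vs≋1 scaled≋0)))
    where
    scaled≋0 : s * (toℕ x ⊖ toℕ y) ≋ 0
    scaled≋0 = trans (sym (image-⊖ x y))
                     (≋⇒⊖≋0 {toℕ (affine s c x)} {toℕ (affine s c y)} (cong (λ z → toℕ z % p) eq))

  edge : ∀ {x y} → x ≢ y →
         colouring (affine s c x) (affine s c y) ≡ exponent (quartic s * root (colouring x y) % p)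
  edge {x} {y} x≢y = cong exponent (begin
    quartic image-difference      ≡⟨ quartic-≋ image-difference (s * difference) (image-⊖ x y) ⟩
    quartic (s * difference)      ≡⟨ quartic-* s difference ⟩
    quartic s * quartic difference % p
      ≡⟨ cong (λ r → quartic s * r % p) (quartic-root difference (distinct⇒nonzero x≢y)) ⟩
    quartic s * root (colouring x y) % p ∎)
    where
    difference image-difference : ℕ
    difference       = toℕ x ⊖ toℕ y
    image-difference = toℕ (affine s c x) ⊖ toℕ (affine s c y)

-- Translating by −a moves a monochromatic K4 onto one through the vertex 0.
translateTo0 : ∀ k a b c d → IsMonoK4 colouring k a b c d →
               Σ[ k′ ∈ Fin 4 ] Σ[ b′ ∈ Fin p ] Σ[ c′ ∈ Fin p ] Σ[ d′ ∈ Fin p ]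
                 IsMonoK4 colouring k′ 0F b′ c′ d′
translateTo0 k a b c d mono =
  recolour k , vertex b , vertex c , vertex d ,
  subst (λ z → IsMonoK4 colouring (recolour k) z (vertex b) (vertex c) (vertex d))
        a↦0 (mapMonoK4 mono)
  where
  open ColourMap (affineMap 1 (456 * toℕ a) 1 refl)
  a↦0 : vertex a ≡ 0F
  a↦0 = toℕ-injective (begin
    toℕ (vertex a)                   ≡⟨ toℕ-affine 1 (456 * toℕ a) a ⟩
    (1 * toℕ a + 456 * toℕ a) % p    ≡⟨ cong (λ z → (z + 456 * toℕ a) % p) (*-identityˡ (toℕ a)) ⟩
    (toℕ a ⊖ toℕ a) % p              ≡⟨ ⊖-self (toℕ a) ⟩
    0                                ∎)
    where open ≡-Reasoning

-- Scaling by the inverse b^455 of b moves a monochromatic K4 through 0 and b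
-- onto one through 0 and 1.
scaleTo1 : ∀ k b c d → IsMonoK4 colouring k 0F b c d →
           Σ[ k′ ∈ Fin 4 ] Σ[ c′ ∈ Fin p ] Σ[ d′ ∈ Fin p ] IsMonoK4 colouring k′ 0F 1F c′ d′
scaleTo1 k b c d mono =
  recolour k , vertex c , vertex d ,
  subst₂ (λ y z → IsMonoK4 colouring (recolour k) y z (vertex c) (vertex d))
         0↦0 b↦1 (mapMonoK4 mono)
  where
  b≢0 : ¬ (toℕ b ≋ 0)
  b≢0 b≋0 = proj₁ (proj₁ mono) (sym (toℕ-injective (<-≋⇒≡ (toℕ<n b) (toℕ<n {p} 0F) b≋0)))

  open ColourMap (affineMap (toℕ b ^ 455) 0 (toℕ b) (fermat (toℕ b) b≢0))

  0↦0 : vertex 0F ≡ 0F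
  0↦0 = toℕ-injective (trans (toℕ-affine (toℕ b ^ 455) 0 0F)
                             (cong (_% p) (trans (+-identityʳ _) (*-zeroʳ (toℕ b ^ 455)))))

  b↦1 : vertex b ≡ 1F
  b↦1 = toℕ-injective (trans (toℕ-affine (toℕ b ^ 455) 0 b)
          (trans (cong (_% p) (trans (+-identityʳ _) (*-comm (toℕ b ^ 455) (toℕ b))))
                 (fermat (toℕ b) b≢0)))

-- Whether x is joined to both 0 and 1 by edges of colour 0F, the colour of
-- the edge {0, 1}.
commonNeighbour? : (x : Fin p) → Dec (colouring 0F x ≡ 0F × colouring 1F x ≡ 0F)
commonNeighbour? x = (colouring 0F x ≟ 0F) ×-dec (colouring 1F x ≟ 0F)

commonNeighbours : List (Fin p)
commonNeighbours = filter commonNeighbour? (allFin p)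

∈-commonNeighbours : ∀ x → colouring 0F x ≡ 0F → colouring 1F x ≡ 0F → x ∈ commonNeighbours
∈-commonNeighbours x χ0x χ1x = ∈-filter⁺ commonNeighbour? (∈-allFin x) (χ0x , χ1x)

commonNeighbours-independent :
  All (λ c → All (λ d → c ≡ d ⊎ colouring c d ≢ 0F) commonNeighbours) commonNeighbours
commonNeighbours-independent = toWitness {a? = All.all? (λ c → All.all? (λ d →
  (c ≟ d) ⊎-dec ¬? (colouring c d ≟ 0F)) commonNeighbours) commonNeighbours} _

-- The edge {0, 1} has colour 0F (1 is a fourth power), so a monochromatic K4
-- through 0 and 1 would consist of two adjacent common neighbours.
noMonoK4Through01 : ∀ k c d → ¬ IsMonoK4 colouring k 0F 1F c d
noMonoK4Through01 k c d ((_ , _ , _ , _ , _ , c≢d) , (χ01 , χ0c , χ0d , χ1c , χ1d , χcd)) =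
  [ c≢d , (λ χcd≢0 → χcd≢0 (colour0 c d χcd)) ]′
    (All.lookup (All.lookup commonNeighbours-independent
                  (∈-commonNeighbours c (colour0 0F c χ0c) (colour0 1F c χ1c)))
                (∈-commonNeighbours d (colour0 0F d χ0d) (colour0 1F d χ1d)))
  where
  colour0 : ∀ x y → colouring x y ≡ k → colouring x y ≡ 0F
  colour0 x y χxy = trans χxy (sym χ01)

-- Every monochromatic K4 could be moved onto one through 0 and 1.
colouring-K4-free : ∀ k a b c d → ¬ IsMonoK4 colouring k a b c d
colouring-K4-free k a b c d mono =
  let (k₀ , b₀ , c₀ , d₀ , mono₀) = translateTo0 k a b c d mono
      (k₀₁ , c₀₁ , d₀₁ , mono₀₁)  = scaleTo1 k₀ b₀ c₀ d₀ mono₀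
  in noMonoK4Through01 k₀₁ c₀₁ d₀₁ mono₀₁

corollary2p8 : (l : ℕ) → RamseyProperty4444 l → 458 ≤ l
corollary2p8 l = ramseyLowerBound colouring colouring-symmetric colouring-K4-free
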